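{- Let $J$ be a recursively aligned set of unit-length jobs that is $m$-machine $\gamma$-underallocated. Then for every aligned window $W$, there are at most $m|W|/\gamma$ jobs in $J$ whose span is at most $|W|$ and whose windows overlap $W$.
   Context: Each job has length $1$, an integer arrival time $a$ and an integer deadline $d > a$. Its window is $[a,d]$ with span $|W| = d-a$, and the job must be scheduled in a unit timeslot inside its window. A window is aligned if its span is $2^i$ for some integer $i \ge 0$ and its start time is a multiple of $2^i$. A set of jobs is recursively aligned if every job's window is aligned. A set of jobs is $m$-machine $\gamma$-underallocated ($\gamma \ge 1$) if it has a feasible schedule on $m$ machines, with no two jobs on the same machine at overlapping times, even when each job's processing time is multiplied by $\gamma$ (each job running within its window).
   Formalization: The parameter γ and the start times of the schedule witnessing $m$-machine $\gamma$-underallocation take rational values. -}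

module Defs where

open import Data.Nat as ℕ using (ℕ)
open import Data.Integer as ℤ using (ℤ; +_)
open import Data.Integer.Divisibility using () renaming (_∣_ to _∣ℤ_)
open import Data.Rational as ℚ using (ℚ)
open import Data.Fin using (Fin)
open import Data.List using (List; length; filter; lookup)
open import Data.Product using (Σ; ∃; _×_; _,_)
open import Data.Sum using (_⊎_)
open import Relation.Binary.PropositionalEquality using (_≡_)
open import Relation.Nullary using (¬_; Dec)
open import Relation.Nullary.Decidable using (_×-dec_)
open import Data.List.Relation.Unary.All using (All)

ℤ→ℚ : ℤ → ℚ
ℤ→ℚ z = z ℚ./ 1

record Window : Set where
  constructor [_,_]
  field
    start : ℤ
    end   : ℤ
open Window public

span : Window → ℤ
span W = end W ℤ.- start W

record Job : Set where
  field
    arrival  : ℤ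
    deadline : ℤ
    a<d      : arrival ℤ.< deadline
open Job public

window : Job → Window
window j = [ arrival j , deadline j ]

Aligned : Window → Set
Aligned W = Σ ℕ λ i → (span W ≡ + (2 ℕ.^ i)) × (+ (2 ℕ.^ i) ∣ℤ start W)

RecursivelyAligned : List Job → Set
RecursivelyAligned J = All (λ j → Aligned (window j)) J

-- m-machine γ-underallocated: there is a schedule on m machines in which
-- every job runs for time γ (start time s, real-valued; here rational)
-- inside its window, and no two distinct jobs on the same machine overlap.
Underallocated : ℕ → ℚ → List Job → Set
Underallocated m γ J =
  Σ (Fin (length J) → Fin m) λ machine →
  Σ (Fin (length J) → ℚ) λ s →
    (∀ k → (ℤ→ℚ (arrival (lookup J k)) ℚ.≤ s k)
         × (s k ℚ.+ γ ℚ.≤ ℤ→ℚ (deadline (lookup J k))))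
  × (∀ k l → ¬ (k ≡ l) → machine k ≡ machine l →
       (s k ℚ.+ γ ℚ.≤ s l) ⊎ (s l ℚ.+ γ ℚ.≤ s k))

Overlaps : Window → Window → Set
Overlaps V W = (start V ℤ.< end W) × (start W ℤ.< end V)

overlaps? : ∀ V W → Dec (Overlaps V W)
overlaps? V W = (start V ℤ.<? end W) ×-dec (start W ℤ.<? end V)

Relevant : Window → Job → Set
Relevant W j = (span (window j) ℤ.≤ span W) × Overlaps (window j) W

relevant? : ∀ W j → Dec (Relevant W j)
relevant? W j = (span (window j) ℤ.≤? span W) ×-dec overlaps? (window j) W

countRelevant : Window → List Job → ℕ
countRelevant W J = length (filter (relevant? W) J)

-- Aligned windows are nested like dyadic intervals: an aligned window of span at most |W|
-- that overlaps the aligned window W lies inside W. So every counted job, when run for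
-- time γ inside its own window, runs inside W. The runs on one machine are pairwise
-- disjoint intervals of length γ in W, hence at most |W|/γ of them, and there are m machines.

module Submission where

open import Defs
open import Data.Nat using (ℕ)
open import Data.Integer using (+_)
open import Data.Rational using (ℚ; _≤_; _*_; 1ℚ)
open import Data.List using (List)

open import Data.Nat as ℕ using (zero; suc)
open import Data.Nat.Divisibility using (_∣_; n∣m*n)
import Data.Nat.Properties as ℕP
import Data.Integer as ℤ
import Data.Integer.Properties as ℤP
open import Data.Integer.Divisibility.Signed as ℤ∣ using (∣ᵤ⇒∣)
open import Data.Integer.Tactic.RingSolver using (solve-∀)
open import Data.Rational as ℚ using (0ℚ)
import Data.Rational.Properties as ℚP
import Data.Rational.Unnormalised as ℚᵘ
import Data.Rational.Unnormalised.Properties as ℚᵘP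
open import Data.Rational.Solver using (module +-*-Solver)
open import Data.Fin as Fin using (Fin)
open import Data.Fin.Properties using (_≟_)
open import Data.List using ([]; _∷_; length; filter; map; lookup; allFin)
import Data.List.Properties as ListP
open import Data.List.Membership.Propositional.Properties using (∈-lookup)
open import Data.List.Relation.Unary.All as All using (All; []; _∷_)
open import Data.List.Relation.Unary.All.Properties using (all-filter; filter⁺)
open import Data.List.Relation.Unary.AllPairs using (AllPairs; []; _∷_)
import Data.List.Relation.Unary.AllPairs.Properties as AllPairsP
open import Data.Product using (_×_; _,_)
open import Data.Sum using (_⊎_; inj₁; inj₂)
open import Data.Bool using (if_then_else_; true; false)
open import Function using (_∘_; id)
open import Relation.Binary.PropositionalEquality
open import Relation.Binary using (Rel)
open import Relation.Nullary using (¬_; does; contradiction)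
open import Relation.Unary using (Pred; Decidable)
open import Relation.Unary.Properties using (∁?)
open import Algebra.Definitions.RawMonoid ℚ.+-0-rawMonoid using () renaming (_×_ to _×ℚ_)
open import Algebra.Properties.Monoid.Mult ℚP.+-0-monoid using (×-homo-+)
open import Algebra.Properties.CommutativeMonoid.Sum ℕP.+-0-commutativeMonoid
  using (∑-distrib-+; sum-cong-≗; sum-replicate-zero)
  renaming (sum to ∑)

toℚᵘ-ℤ→ℚ : ∀ a → ℚ.toℚᵘ (ℤ→ℚ a) ℚᵘ.≃ ℚᵘ.mkℚᵘ a 0
toℚᵘ-ℤ→ℚ a = ℚP.toℚᵘ-fromℚᵘ (ℚᵘ.mkℚᵘ a 0)

ℤ→ℚ-homo-+ : ∀ a b → ℤ→ℚ (a ℤ.+ b) ≡ ℤ→ℚ a ℚ.+ ℤ→ℚ b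
ℤ→ℚ-homo-+ a b = ℚP.toℚᵘ-injective (begin
  ℚ.toℚᵘ (ℤ→ℚ (a ℤ.+ b))               ≈⟨ toℚᵘ-ℤ→ℚ (a ℤ.+ b) ⟩
  ℚᵘ.mkℚᵘ (a ℤ.+ b) 0                  ≈⟨ ℚᵘ.*≡* (cong₂ (λ x y → (x ℤ.+ y) ℤ.* + 1) (sym (ℤP.*-identityʳ a)) (sym (ℤP.*-identityʳ b))) ⟩
  ℚᵘ.mkℚᵘ a 0 ℚᵘ.+ ℚᵘ.mkℚᵘ b 0         ≈⟨ ℚᵘP.+-cong (toℚᵘ-ℤ→ℚ a) (toℚᵘ-ℤ→ℚ b) ⟨
  ℚ.toℚᵘ (ℤ→ℚ a) ℚᵘ.+ ℚ.toℚᵘ (ℤ→ℚ b)   ≈⟨ ℚP.toℚᵘ-homo-+ (ℤ→ℚ a) (ℤ→ℚ b) ⟨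
  ℚ.toℚᵘ (ℤ→ℚ a ℚ.+ ℤ→ℚ b)             ∎)
  where open ℚᵘP.≃-Reasoning

ℤ→ℚ-mono-≤ : ∀ {a b} → a ℤ.≤ b → ℤ→ℚ a ≤ ℤ→ℚ b
ℤ→ℚ-mono-≤ {a} {b} a≤b = ℚP.toℚᵘ-cancel-≤ (begin
  ℚ.toℚᵘ (ℤ→ℚ a)  ≃⟨ toℚᵘ-ℤ→ℚ a ⟩
  ℚᵘ.mkℚᵘ a 0     ≤⟨ ℚᵘ.*≤* (ℤP.*-monoʳ-≤-nonNeg (+ 1) a≤b) ⟩
  ℚᵘ.mkℚᵘ b 0     ≃⟨ toℚᵘ-ℤ→ℚ b ⟨
  ℚ.toℚᵘ (ℤ→ℚ b)  ∎)
  where open ℚᵘP.≤-Reasoning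

ℤ→ℚ-homo-minus : ∀ a b → ℤ→ℚ (a ℤ.- b) ≡ ℤ→ℚ a ℚ.- ℤ→ℚ b
ℤ→ℚ-homo-minus a b = begin
  ℤ→ℚ (a ℤ.- b)                            ≡⟨ +-*-Solver.solve 2 (λ x y → x := (x :+ y) :- y) refl (ℤ→ℚ (a ℤ.- b)) (ℤ→ℚ b) ⟩
  (ℤ→ℚ (a ℤ.- b) ℚ.+ ℤ→ℚ b) ℚ.- ℤ→ℚ b      ≡⟨ cong (ℚ._- ℤ→ℚ b) (ℤ→ℚ-homo-+ (a ℤ.- b) b) ⟨
  ℤ→ℚ (a ℤ.- b ℤ.+ b) ℚ.- ℤ→ℚ b            ≡⟨ cong (λ x → ℤ→ℚ x ℚ.- ℤ→ℚ b) (i-j+j≡i a b) ⟩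
  ℤ→ℚ a ℚ.- ℤ→ℚ b                          ∎
  where
  open ≡-Reasoning
  open +-*-Solver
  i-j+j≡i : ∀ a b → a ℤ.- b ℤ.+ b ≡ a
  i-j+j≡i = solve-∀

×ℚ≡ℤ→ℚ* : ∀ n x → n ×ℚ x ≡ ℤ→ℚ (+ n) * x
×ℚ≡ℤ→ℚ* zero x = sym (ℚP.*-zeroˡ x)
×ℚ≡ℤ→ℚ* (suc n) x = begin
  x ℚ.+ n ×ℚ x                    ≡⟨ cong (x ℚ.+_) (×ℚ≡ℤ→ℚ* n x) ⟩
  x ℚ.+ ℤ→ℚ (+ n) * x             ≡⟨ cong (ℚ._+ ℤ→ℚ (+ n) * x) (ℚP.*-identityˡ x) ⟨
  1ℚ * x ℚ.+ ℤ→ℚ (+ n) * x        ≡⟨ ℚP.*-distribʳ-+ x 1ℚ (ℤ→ℚ (+ n)) ⟨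
  (1ℚ ℚ.+ ℤ→ℚ (+ n)) * x          ≡⟨ cong (_* x) (ℤ→ℚ-homo-+ (+ 1) (+ n)) ⟨
  ℤ→ℚ (+ suc n) * x               ∎
  where open ≡-Reasoning

Inside : Window → Window → Set
Inside V W = start W ℤ.≤ start V × end V ℤ.≤ end W

end≡start+ : ∀ W {d} → span W ≡ d → end W ≡ start W ℤ.+ d
end≡start+ W refl = j≡i+[j-i] (start W) (end W)
  where
  j≡i+[j-i] : ∀ i j → j ≡ i ℤ.+ (j ℤ.- i)
  j≡i+[j-i] = solve-∀

^-cancelˡ-≤ : ∀ m {i k} → 1 ℕ.< m → m ℕ.^ i ℕ.≤ m ℕ.^ k → i ℕ.≤ k
^-cancelˡ-≤ m 1<m mⁱ≤mᵏ = ℕP.≮⇒≥ (λ k<i → ℕP.<⇒≱ (ℕP.^-monoʳ-< m 1<m k<i) mⁱ≤mᵏ)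

^-monoʳ-∣ : ∀ m {i k} → i ℕ.≤ k → m ℕ.^ i ∣ m ℕ.^ k
^-monoʳ-∣ m {i} {k} i≤k = subst (m ℕ.^ i ∣_) mᵏ≡ (n∣m*n (m ℕ.^ (k ℕ.∸ i)))
  where
  mᵏ≡ : m ℕ.^ (k ℕ.∸ i) ℕ.* m ℕ.^ i ≡ m ℕ.^ k
  mᵏ≡ = trans (sym (ℕP.^-distribˡ-+-* m (k ℕ.∸ i) i)) (cong (m ℕ.^_) (ℕP.m∸n+n≡m i≤k))

gridCell-inside : ∀ {p V W} .{{_ : ℤ.NonNegative p}} →
  p ℤ∣.∣ start V → end V ≡ start V ℤ.+ p → p ℤ∣.∣ start W → p ℤ∣.∣ end W →
  Overlaps V W → Inside V W
gridCell-inside {p} {V} {W} (ℤ∣.divides α sV≡αp) eV≡sV+p (ℤ∣.divides σ sW≡σp) (ℤ∣.divides τ eW≡τp) (sV<eW , sW<eV) =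
  subst₂ ℤ._≤_ (sym sW≡σp) (sym sV≡αp) (ℤP.*-monoʳ-≤-nonNeg p σ≤α) ,
  subst₂ ℤ._≤_ (sym eV≡[α+1]p) (sym eW≡τp) (ℤP.*-monoʳ-≤-nonNeg p (ℤP.i<j⇒suc[i]≤j α<τ))
  where
  eV≡[α+1]p : end V ≡ ℤ.suc α ℤ.* p
  eV≡[α+1]p = begin
    end V              ≡⟨ eV≡sV+p ⟩
    start V ℤ.+ p      ≡⟨ cong (ℤ._+ p) sV≡αp ⟩
    α ℤ.* p ℤ.+ p      ≡⟨ ℤP.+-comm (α ℤ.* p) p ⟩
    p ℤ.+ α ℤ.* p      ≡⟨ ℤP.suc-* α p ⟨
    ℤ.suc α ℤ.* p      ∎
    where open ≡-Reasoning
  σ≤α : σ ℤ.≤ α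
  σ≤α = subst (σ ℤ.≤_) (ℤP.pred-suc α) (ℤP.i<j⇒i≤pred[j] (ℤP.*-cancelʳ-<-nonNeg {σ} {ℤ.suc α} p (subst₂ ℤ._<_ sW≡σp eV≡[α+1]p sW<eV)))
  α<τ : α ℤ.< τ
  α<τ = ℤP.*-cancelʳ-<-nonNeg {α} {τ} p (subst₂ ℤ._<_ sV≡αp eW≡τp sV<eW)

aligned-nested : ∀ {V W} → Aligned V → Aligned W → span V ℤ.≤ span W → Overlaps V W → Inside V W
aligned-nested {V} {W} (i , spanV≡ , 2ⁱ∣sV) (k , spanW≡ , 2ᵏ∣sW) spanV≤spanW =
  gridCell-inside (∣ᵤ⇒∣ 2ⁱ∣sV) (end≡start+ V spanV≡) 2ⁱ∣sW 2ⁱ∣eW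
  where
  2ⁱ∣2ᵏ : + (2 ℕ.^ i) ℤ∣.∣ + (2 ℕ.^ k)
  2ⁱ∣2ᵏ = ∣ᵤ⇒∣ (^-monoʳ-∣ 2 {i} {k} (^-cancelˡ-≤ 2 {i} {k} (ℕP.n<1+n 1) (ℤP.drop‿+≤+ (subst₂ ℤ._≤_ spanV≡ spanW≡ spanV≤spanW))))
  2ⁱ∣sW : + (2 ℕ.^ i) ℤ∣.∣ start W
  2ⁱ∣sW = ℤ∣.∣-trans 2ⁱ∣2ᵏ (∣ᵤ⇒∣ 2ᵏ∣sW)
  2ⁱ∣eW : + (2 ℕ.^ i) ℤ∣.∣ end W
  2ⁱ∣eW = subst (+ (2 ℕ.^ i) ℤ∣.∣_) (sym (end≡start+ W spanW≡)) (ℤ∣.∣m∣n⇒∣m+n 2ⁱ∣sW 2ⁱ∣2ᵏ)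

aligned⇒start≤end : ∀ {W} → Aligned W → start W ℤ.≤ end W
aligned⇒start≤end {W} (k , spanW≡ , _) =
  subst (start W ℤ.≤_) (sym (end≡start+ W spanW≡)) (ℤP.i≤i+j (start W) (+ (2 ℕ.^ k)))

module _ {a p} {A : Set a} {P : Pred A p} (P? : Decidable P) where

  length-filter+length-filter-∁ : ∀ xs → length (filter P? xs) ℕ.+ length (filter (∁? P?) xs) ≡ length xs
  length-filter+length-filter-∁ [] = refl
  length-filter+length-filter-∁ (x ∷ xs) with does (P? x)
  ... | true  = cong suc (length-filter+length-filter-∁ xs)
  ... | false = trans (ℕP.+-suc _ _) (cong suc (length-filter+length-filter-∁ xs))

  length-filter-∘ : ∀ {b} {B : Set b} (f : B → A) xs → length (filter (P? ∘ f) xs) ≡ length (filter P? (map f xs))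
  length-filter-∘ f [] = refl
  length-filter-∘ f (x ∷ xs) with does (P? (f x))
  ... | true  = cong suc (length-filter-∘ f xs)
  ... | false = length-filter-∘ f xs

runs-inside : ∀ {j W γ t} → Aligned (window j) → Aligned W → Relevant W j →
  ℤ→ℚ (arrival j) ≤ t × t ℚ.+ γ ≤ ℤ→ℚ (deadline j) → ℤ→ℚ (start W) ≤ t × t ℚ.+ γ ≤ ℤ→ℚ (end W)
runs-inside alignedj alignedW (span≤ , overlaps) (a≤t , t+γ≤d) =
  let (S≤a , d≤E) = aligned-nested alignedj alignedW span≤ overlaps
  in ℚP.≤-trans (ℤ→ℚ-mono-≤ S≤a) a≤t , ℚP.≤-trans t+γ≤d (ℤ→ℚ-mono-≤ d≤E)

p≤q⇒0≤q-p : ∀ {p q} → p ≤ q → 0ℚ ≤ q ℚ.- p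
p≤q⇒0≤q-p {p} {q} p≤q = subst (_≤ q ℚ.- p) (ℚP.+-inverseʳ p) (ℚP.+-monoˡ-≤ (ℚ.- p) p≤q)

module Packing {I : Set} (s : I → ℚ) (γ : ℚ) where

  Apart : I → I → Set
  Apart k l = s k ℚ.+ γ ≤ s l ⊎ s l ℚ.+ γ ≤ s k

  Between : ℚ → ℚ → I → Set
  Between A B k = A ≤ s k × s k ℚ.+ γ ≤ B

  -- Split at the first job x: the others run either before it, inside [A, s x], or after it, inside [s x + γ, B].
  packing : ∀ {A B} ks → A ≤ B → AllPairs Apart ks → All (Between A B) ks → length ks ×ℚ γ ≤ B ℚ.- A
  packing ks = packing-≤ (length ks) ks ℕP.≤-refl
    where
    packing-≤ : ∀ n {A B} ks → length ks ℕ.≤ n →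
                A ≤ B → AllPairs Apart ks → All (Between A B) ks → length ks ×ℚ γ ≤ B ℚ.- A
    packing-≤ _ [] _ A≤B _ _ = p≤q⇒0≤q-p A≤B
    packing-≤ (suc n) {A} {B} (x ∷ xs) (ℕ.s≤s |xs|≤n) _ (x-apart ∷ apart) ((A≤sx , sx+γ≤B) ∷ between) = begin
      γ ℚ.+ length xs ×ℚ γ                                        ≡⟨ cong (λ l → γ ℚ.+ l ×ℚ γ) (length-filter+length-filter-∁ earlier? xs) ⟨
      γ ℚ.+ (length earlier ℕ.+ length later) ×ℚ γ                ≡⟨ cong (γ ℚ.+_) (×-homo-+ γ (length earlier) (length later)) ⟩
      γ ℚ.+ (length earlier ×ℚ γ ℚ.+ length later ×ℚ γ)           ≤⟨ ℚP.+-monoʳ-≤ γ (ℚP.+-mono-≤ earlier-bound later-bound) ⟩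
      γ ℚ.+ ((s x ℚ.- A) ℚ.+ (B ℚ.- (s x ℚ.+ γ)))                 ≡⟨ telescope γ (s x) A B ⟩
      B ℚ.- A                                                     ∎
      where
      open ℚP.≤-Reasoning
      earlier? : Decidable (λ y → s y ℚ.+ γ ≤ s x)
      earlier? y = s y ℚ.+ γ ℚ.≤? s x
      earlier later : List I
      earlier = filter earlier? xs
      later = filter (∁? earlier?) xs
      runs-after : ∀ {y} → (Between A B y × Apart x y) × ¬ (s y ℚ.+ γ ≤ s x) → Between (s x ℚ.+ γ) B y
      runs-after (((_ , sy+γ≤B) , inj₁ sx+γ≤sy) , _) = sx+γ≤sy , sy+γ≤B
      runs-after ((_ , inj₂ sy+γ≤sx) , not-earlier) = contradiction sy+γ≤sx not-earlier
      earlier-bound : length earlier ×ℚ γ ≤ s x ℚ.- A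
      earlier-bound = packing-≤ n earlier (ℕP.≤-trans (ListP.length-filter earlier? xs) |xs|≤n) A≤sx
        (AllPairsP.filter⁺ earlier? apart)
        (All.zipWith (λ ((A≤sy , _) , sy+γ≤sx) → A≤sy , sy+γ≤sx) (filter⁺ earlier? between , all-filter earlier? xs))
      later-bound : length later ×ℚ γ ≤ B ℚ.- (s x ℚ.+ γ)
      later-bound = packing-≤ n later (ℕP.≤-trans (ListP.length-filter (∁? earlier?) xs) |xs|≤n) sx+γ≤B
        (AllPairsP.filter⁺ (∁? earlier?) apart)
        (All.zipWith runs-after (filter⁺ (∁? earlier?) (All.zip (between , x-apart)) , all-filter (∁? earlier?) xs))
      telescope : ∀ g y a b → g ℚ.+ ((y ℚ.- a) ℚ.+ (b ℚ.- (y ℚ.+ g))) ≡ b ℚ.- a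
      telescope = +-*-Solver.solve 4 (λ g y a b → g :+ ((y :- a) :+ (b :- (y :+ g))) := b :- a) refl
        where open +-*-Solver

module _ {a} {A : Set a} {m : ℕ} (f : A → Fin m) where

  fibre? : (t : Fin m) → Decidable (λ x → f x ≡ t)
  fibre? t x = f x ≟ t

  length-filter-fibre-∷ : ∀ t x xs →
    length (filter (fibre? t) (x ∷ xs)) ≡ (if does (f x ≟ t) then 1 else 0) ℕ.+ length (filter (fibre? t) xs)
  length-filter-fibre-∷ t x xs with does (f x ≟ t)
  ... | true  = refl
  ... | false = refl

  AllPairs-fibre : ∀ {r} {R : Rel A r} {t xs} →
    All (λ x → f x ≡ t) xs → AllPairs (λ x y → f x ≡ f y → R x y) xs → AllPairs R xs
  AllPairs-fibre [] [] = []
  AllPairs-fibre (fx≡t ∷ fxs≡t) (Rx ∷ Rxs) =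
    All.zipWith (λ (fy≡t , Rxy) → Rxy (trans fx≡t (sym fy≡t))) (fxs≡t , Rx) ∷ AllPairs-fibre fxs≡t Rxs

  length≡∑-fibres : ∀ xs → length xs ≡ ∑ (λ t → length (filter (fibre? t) xs))
  length≡∑-fibres [] = sym (sum-replicate-zero m)
  length≡∑-fibres (x ∷ xs) = begin
    suc (length xs)                                                          ≡⟨ cong₂ ℕ._+_ (sym (∑-indicator (f x))) (length≡∑-fibres xs) ⟩
    ∑ (λ t → if does (f x ≟ t) then 1 else 0) ℕ.+ ∑ (λ t → length (filter (fibre? t) xs))
                                                                             ≡⟨ ∑-distrib-+ (λ t → if does (f x ≟ t) then 1 else 0) (λ t → length (filter (fibre? t) xs)) ⟨
    ∑ (λ t → (if does (f x ≟ t) then 1 else 0) ℕ.+ length (filter (fibre? t) xs))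
                                                                             ≡⟨ sum-cong-≗ (λ t → sym (length-filter-fibre-∷ t x xs)) ⟩
    ∑ (λ t → length (filter (fibre? t) (x ∷ xs)))                            ∎
    where
    open ≡-Reasoning
    ∑-indicator : ∀ {n} (c : Fin n) → ∑ (λ t → if does (c ≟ t) then 1 else 0) ≡ 1
    ∑-indicator {suc n} Fin.zero = cong suc (sum-replicate-zero n)
    ∑-indicator {suc n} (Fin.suc c) = ∑-indicator c

∑×ℚ-≤ : ∀ {m} (c : Fin m → ℕ) {γ D} → (∀ t → c t ×ℚ γ ≤ D) → ∑ c ×ℚ γ ≤ m ×ℚ D
∑×ℚ-≤ {zero} c _ = ℚP.≤-refl
∑×ℚ-≤ {suc m} c {γ} {D} bound =
  subst (_≤ suc m ×ℚ D) (sym (×-homo-+ γ (c Fin.zero) (∑ (c ∘ Fin.suc))))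
    (ℚP.+-mono-≤ (bound Fin.zero) (∑×ℚ-≤ (c ∘ Fin.suc) (bound ∘ Fin.suc)))

relevantIndices : Window → (J : List Job) → List (Fin (length J))
relevantIndices W J = filter (relevant? W ∘ lookup J) (allFin (length J))

countRelevant≡length-relevantIndices : ∀ W J → countRelevant W J ≡ length (relevantIndices W J)
countRelevant≡length-relevantIndices W J = begin
  length (filter (relevant? W) J)                                      ≡⟨ cong (length ∘ filter (relevant? W)) J≡ ⟩
  length (filter (relevant? W) (map (lookup J) (allFin (length J))))   ≡⟨ length-filter-∘ (relevant? W) (lookup J) (allFin (length J)) ⟨
  length (filter (relevant? W ∘ lookup J) (allFin (length J)))         ∎
  where
  open ≡-Reasoning
  J≡ : J ≡ map (lookup J) (allFin (length J))
  J≡ = trans (sym (ListP.tabulate-lookup J)) (sym (ListP.map-tabulate id (lookup J)))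

lemma1 : (m : ℕ) (γ : ℚ) (J : List Job) → 1ℚ ≤ γ →
    RecursivelyAligned J → Underallocated m γ J →
    (W : Window) → Aligned W →
    ℤ→ℚ (+ countRelevant W J) * γ ≤ ℤ→ℚ (+ m) * ℤ→ℚ (span W)
-- The bound holds for every γ.
lemma1 m γ J _ aligned (machine , s , inWindow , disjoint) W alignedW = begin
  ℤ→ℚ (+ countRelevant W J) * γ                     ≡⟨ cong (λ n → ℤ→ℚ (+ n) * γ) (countRelevant≡length-relevantIndices W J) ⟩
  ℤ→ℚ (+ length R) * γ                              ≡⟨ ×ℚ≡ℤ→ℚ* (length R) γ ⟨
  length R ×ℚ γ                                     ≡⟨ cong (_×ℚ γ) (length≡∑-fibres machine R) ⟩
  ∑ (λ t → length (onMachine t)) ×ℚ γ               ≤⟨ ∑×ℚ-≤ (λ t → length (onMachine t)) per-machine ⟩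
  m ×ℚ (ℤ→ℚ (end W) ℚ.- ℤ→ℚ (start W))              ≡⟨ ×ℚ≡ℤ→ℚ* m _ ⟩
  ℤ→ℚ (+ m) * (ℤ→ℚ (end W) ℚ.- ℤ→ℚ (start W))       ≡⟨ cong (ℤ→ℚ (+ m) *_) (ℤ→ℚ-homo-minus (end W) (start W)) ⟨
  ℤ→ℚ (+ m) * ℤ→ℚ (span W)                          ∎
  where
  open ℚP.≤-Reasoning hiding (start)
  open Packing s γ
  R : List (Fin (length J))
  R = relevantIndices W J
  onMachine : Fin m → List (Fin (length J))
  onMachine t = filter (fibre? machine t) R
  inside : ∀ {k} → Relevant W (lookup J k) → Between (ℤ→ℚ (start W)) (ℤ→ℚ (end W)) k
  inside {k} relevant = runs-inside {lookup J k} (All.lookup aligned (∈-lookup k)) alignedW relevant (inWindow k)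
  separated : AllPairs (λ k l → machine k ≡ machine l → Apart k l) R
  separated = AllPairsP.filter⁺ (relevant? W ∘ lookup J) (AllPairsP.tabulate⁺ (λ {k} {l} k≢l → disjoint k l k≢l))
  per-machine : ∀ t → length (onMachine t) ×ℚ γ ≤ ℤ→ℚ (end W) ℚ.- ℤ→ℚ (start W)
  per-machine t = packing {ℤ→ℚ (start W)} {ℤ→ℚ (end W)} (onMachine t) (ℤ→ℚ-mono-≤ (aligned⇒start≤end {W} alignedW))
    (AllPairs-fibre machine (all-filter (fibre? machine t) R) (AllPairsP.filter⁺ (fibre? machine t) separated))
    (filter⁺ (fibre? machine t) (All.map inside (all-filter (relevant? W ∘ lookup J) (allFin (length J)))))
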